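{- Let $n\geq 4$ be an integer. There exist integers $s,t$ satisfying $1 \leq s < t \leq \lfloor n/2 \rfloor$ such that the graph $G(C_n, \{s,t\})$ contains a copy of $K_5$ if and only if $5$ divides $n$.
   Context: $C_n$ is the cycle with vertex set $\mathbb{Z}_n=\{0,1,\dots,n-1\}$, $i$ adjacent to $i\pm1 \pmod n$; the graph distance is $\mathrm{dist}(i,j)=\min(|i-j|,\,n-|i-j|)$. For a set $D$ of positive integers, the distance graph $G(C_n,D)$ has vertex set $\mathbb{Z}_n$, with distinct $i,j$ adjacent iff $\mathrm{dist}(i,j)\in D$. -}

module Defs where

open import Data.Nat using (ℕ; _⊓_; _∸_; ∣_-_∣)
open import Data.Fin using (Fin; toℕ)
open import Data.Product using (Σ; _×_)
open import Relation.Binary.PropositionalEquality using (_≡_; _≢_)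
open import Function.Definitions using (Injective)

dist : (n : ℕ) → Fin n → Fin n → ℕ
dist n i j = ∣ toℕ i - toℕ j ∣ ⊓ (n ∸ ∣ toℕ i - toℕ j ∣)

Adj : (n : ℕ) → (ℕ → Set) → Fin n → Fin n → Set
Adj n D i j = (i ≢ j) × D (dist n i j)

Pair : ℕ → ℕ → ℕ → Set
Pair s t d = (d ≡ s) ⊎' (d ≡ t)
  where
  open import Data.Sum using () renaming (_⊎_ to _⊎'_)

ContainsK5 : (n : ℕ) → (ℕ → Set) → Set
ContainsK5 n D =
  Σ (Fin 5 → Fin n) λ f → Injective _≡_ _≡_ f × (∀ a b → a ≢ b → Adj n D (f a) (f b))

module Submission where

-- Sort the five vertices of a K₅ around C_n and let g₁, …, g₅ be the cyclic gaps between
-- consecutive ones, so that they sum to n. A run of one or two consecutive gaps joins two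
-- vertices, so its length or the complementary length lies in {s, t}. Two consecutive gaps
-- cover at most t: otherwise the other three gaps are complementary to them and so cover at
-- most t, whereas any three consecutive gaps cover more than t. Hence every gap is shorter
-- than t, so equals s, and n = 5s. Conversely G(C₅, {1, 2}) is K₅, and multiplying the
-- vertices by q embeds it in G(C_{5q}, {q, 2q}).

open import Defs
open import Data.Nat using (ℕ; zero; suc; _+_; _*_; _∸_; _⊓_; ∣_-_∣; _≤_; _≰_; _<_; _/_; s≤s; z≤n; NonZero)
open import Data.Nat.Properties
open import Data.Nat.DivMod using (m/n*n≤m; m*n/n≡m; /-monoˡ-≤)
open import Data.Nat.Divisibility using (_∣_; divides)
open import Data.Nat.Tactic.RingSolver using (solve-∀; solve)
open import Data.Fin as F using (Fin; toℕ; fromℕ<)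
open import Data.Fin.Properties using (toℕ-injective; toℕ<n; toℕ-fromℕ<; all?)
open import Data.Sum as Sum using (inj₁; inj₂)
open import Data.Product using (Σ; _×_; _,_; proj₂)
open import Data.List using (List; []; _∷_; length; tabulate)
open import Data.List.Membership.Propositional using (_∈_)
open import Data.List.Membership.Propositional.Properties using (∈-tabulate⁻)
open import Data.List.Relation.Unary.Any using (here; there)
open import Data.List.Relation.Unary.All using ([]; _∷_)
open import Data.List.Relation.Unary.AllPairs using ([]; _∷_)
open import Data.List.Relation.Unary.Linked using (Linked; [-]; _∷_)
open import Data.List.Relation.Unary.Unique.Propositional using (Unique)
open import Data.List.Relation.Unary.Unique.Propositional.Properties using (tabulate⁺)
open import Data.List.Relation.Binary.Permutation.Propositional using (↭-sym; ↭⇒↭ₛ)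
open import Data.List.Relation.Binary.Permutation.Propositional.Properties using (∈-resp-↭; ↭-length)
open import Data.List.Relation.Binary.Permutation.Setoid.Properties using (Unique-resp-↭)
open import Data.List.Sort ≤-decTotalOrder using (sort; sort-↭; sort-↗)
open import Relation.Nullary using (contradiction)
open import Relation.Nullary.Decidable using (toWitness; ¬?; _→-dec_; _⊎-dec_)
open import Relation.Binary.PropositionalEquality
open import Function using (_∘_)
open import Function.Definitions using (Injective)
open import Function.Bundles using (_⇔_; mk⇔)

distℕ : ℕ → ℕ → ℕ → ℕ
distℕ n x y = ∣ x - y ∣ ⊓ (n ∸ ∣ x - y ∣)

distℕ-shift : ∀ n x d → distℕ n x (x + d) ≡ d ⊓ (n ∸ d)
distℕ-shift n x d = cong (λ k → k ⊓ (n ∸ k)) (∣m-m+n∣≡n x d)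

+-double : ∀ m → m + m ≡ m * 2
+-double = solve-∀

≤/2⇒+≤ : ∀ {m n} → m ≤ n / 2 → m + m ≤ n
≤/2⇒+≤ {m} {n} m≤n/2 = subst (_≤ n) (sym (+-double m)) (≤-trans (*-monoˡ-≤ 2 m≤n/2) (m/n*n≤m n 2))

+≤⇒≤/2 : ∀ {m n} → m + m ≤ n → m ≤ n / 2
+≤⇒≤/2 {m} {n} m+m≤n = subst (_≤ n / 2) (m*n/n≡m m 2) (/-monoˡ-≤ 2 (subst (_≤ n) (+-double m) m+m≤n))

distℕ-*ˡ : ∀ q m x y → distℕ (q * m) (q * x) (q * y) ≡ q * distℕ m x y
distℕ-*ˡ q m x y = begin
  ∣ q * x - q * y ∣ ⊓ (q * m ∸ ∣ q * x - q * y ∣) ≡⟨ cong (λ k → k ⊓ (q * m ∸ k)) (sym (*-distribˡ-∣-∣ q x y)) ⟩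
  (q * ∣ x - y ∣) ⊓ (q * m ∸ q * ∣ x - y ∣)       ≡⟨ cong ((q * ∣ x - y ∣) ⊓_) (sym (*-distribˡ-∸ q m ∣ x - y ∣)) ⟩
  (q * ∣ x - y ∣) ⊓ (q * (m ∸ ∣ x - y ∣))         ≡⟨ sym (*-distribˡ-⊓ q ∣ x - y ∣ (m ∸ ∣ x - y ∣)) ⟩
  q * distℕ m x y                                 ∎
  where open ≡-Reasoning

Chord : ℕ → ℕ → ℕ → ℕ → ℕ → Set
Chord n s t x y = Pair s t (distℕ n x y)

data Admissible (n s t x : ℕ) : Set where
  short : Pair s t x → Admissible n s t x
  long  : ∀ {v} → Pair s t v → x + v ≡ n → Admissible n s t x

admissible-span : ∀ {n s t y} x d → Chord n s t x y → y ≤ n → x + d ≡ y → Admissible n s t d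
admissible-span {n} {s} {t} x d chord x+d≤n refl with ⊓-sel d (n ∸ d)
... | inj₁ min≡d   = short (subst (Pair s t) (trans (distℕ-shift n x d) min≡d) chord)
... | inj₂ min≡n∸d = long (subst (Pair s t) (trans (distℕ-shift n x d) min≡n∸d) chord)
                          (m+[n∸m]≡n (≤-trans (m≤n+m d x) x+d≤n))

admissible-complement : ∀ {n s t d e} → Admissible n s t d → d + e ≡ n → Admissible n s t e
admissible-complement {d = d} {e} (short p) d+e≡n = long p (trans (+-comm e d) d+e≡n)
admissible-complement {d = d} (long p d+v≡n) d+e≡n =
  short (subst (Pair _ _) (+-cancelˡ-≡ d _ _ (trans d+v≡n (sym d+e≡n))) p)

+-rotate₅ : ∀ a b c d e → b + c + d + e + a ≡ a + b + c + d + e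
+-rotate₅ = solve-∀

+-split₂₃ : ∀ a b c d e → a + b + (c + d + e) ≡ a + b + c + d + e
+-split₂₃ = solve-∀

+-five-copies : ∀ x → x + x + x + x + x ≡ x * 5
+-five-copies = solve-∀

-- Runs of three or four gaps are complements of runs of two or one, so need not be recorded.
record GapCycle (n s t : ℕ) : Set where
  field
    g₁ g₂ g₃ g₄ g₅ : ℕ
    total : g₁ + g₂ + g₃ + g₄ + g₅ ≡ n
    adm₁ : Admissible n s t g₁
    adm₂ : Admissible n s t g₂
    adm₃ : Admissible n s t g₃
    adm₄ : Admissible n s t g₄
    adm₅ : Admissible n s t g₅
    adm₁₂ : Admissible n s t (g₁ + g₂)
    adm₂₃ : Admissible n s t (g₂ + g₃)
    adm₃₄ : Admissible n s t (g₃ + g₄)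
    adm₄₅ : Admissible n s t (g₄ + g₅)
    adm₅₁ : Admissible n s t (g₅ + g₁)

rotate : ∀ {n s t} → GapCycle n s t → GapCycle n s t
rotate c = record
  { g₁ = g₂ ; g₂ = g₃ ; g₃ = g₄ ; g₄ = g₅ ; g₅ = g₁
  ; total = trans (+-rotate₅ g₁ g₂ g₃ g₄ g₅) total
  ; adm₁ = adm₂ ; adm₂ = adm₃ ; adm₃ = adm₄ ; adm₄ = adm₅ ; adm₅ = adm₁
  ; adm₁₂ = adm₂₃ ; adm₂₃ = adm₃₄ ; adm₃₄ = adm₄₅ ; adm₄₅ = adm₅₁ ; adm₅₁ = adm₁₂
  }
  where open GapCycle c

module _ {n s t : ℕ} (0<s : 0 < s) (s≤t : s ≤ t) (t+t≤n : t + t ≤ n) where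

  pair≤t : ∀ {x} → Pair s t x → x ≤ t
  pair≤t (inj₁ refl) = s≤t
  pair≤t (inj₂ refl) = ≤-refl

  long⇒t≤ : ∀ {x v} → Pair s t v → x + v ≡ n → t ≤ x
  long⇒t≤ p x+v≡n = ≮⇒≥ λ x<t → <-irrefl x+v≡n (<-≤-trans (+-mono-<-≤ x<t (pair≤t p)) t+t≤n)

  s≤admissible : ∀ {x} → Admissible n s t x → s ≤ x
  s≤admissible (short (inj₁ refl)) = ≤-refl
  s≤admissible (short (inj₂ refl)) = s≤t
  s≤admissible (long p x+v≡n)      = ≤-trans s≤t (long⇒t≤ p x+v≡n)

  0<admissible : ∀ {x} → Admissible n s t x → 0 < x
  0<admissible adm = <-≤-trans 0<s (s≤admissible adm)

  admissible<t⇒≡s : ∀ {x} → Admissible n s t x → x < t → x ≡ s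
  admissible<t⇒≡s (short (inj₁ x≡s)) _ = x≡s
  admissible<t⇒≡s (short (inj₂ refl)) t<t = contradiction t<t (<-irrefl refl)
  admissible<t⇒≡s (long p x+v≡n) x<t = contradiction (long⇒t≤ p x+v≡n) (<⇒≱ x<t)

  -- a + b < t forces a + b = s, which is too short for two admissible spans.
  three-admissible≰t : ∀ {a b c} → Admissible n s t a → Admissible n s t b → Admissible n s t c →
                       Admissible n s t (a + b) → a + b + c ≰ t
  three-admissible≰t {a} {b} adm-a adm-b adm-c adm-ab a+b+c≤t = <-irrefl (sym a+b≡s) s<a+b
    where
    a+b≡s : a + b ≡ s
    a+b≡s = admissible<t⇒≡s adm-ab (<-≤-trans (m<m+n (a + b) (0<admissible adm-c)) a+b+c≤t)
    s<a+b : s < a + b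
    s<a+b = ≤-<-trans (s≤admissible adm-a) (m<m+n a (0<admissible adm-b))

  module _ (c : GapCycle n s t) where
    open GapCycle c

    g₁+g₂≤t : g₁ + g₂ ≤ t
    g₁+g₂≤t with adm₁₂
    ... | short p = pair≤t p
    ... | long {v} p g₁+g₂+v≡n = contradiction g₃+g₄+g₅≤t (three-admissible≰t adm₃ adm₄ adm₅ adm₃₄)
      where
      g₃+g₄+g₅≡v : g₃ + g₄ + g₅ ≡ v
      g₃+g₄+g₅≡v = +-cancelˡ-≡ (g₁ + g₂) _ _
        (trans (+-split₂₃ g₁ g₂ g₃ g₄ g₅) (trans total (sym g₁+g₂+v≡n)))
      g₃+g₄+g₅≤t : g₃ + g₄ + g₅ ≤ t
      g₃+g₄+g₅≤t = subst (_≤ t) (sym g₃+g₄+g₅≡v) (pair≤t p)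

    g₁≡s : g₁ ≡ s
    g₁≡s = admissible<t⇒≡s adm₁ (<-≤-trans (m<m+n g₁ (0<admissible adm₂)) g₁+g₂≤t)

  gapCycle⇒5∣n : GapCycle n s t → 5 ∣ n
  gapCycle⇒5∣n c = divides s (begin
    n                       ≡⟨ sym total ⟩
    g₁ + g₂ + g₃ + g₄ + g₅  ≡⟨ five-copies (g₁≡s c) (g₁≡s c₂) (g₁≡s c₃) (g₁≡s c₄) (g₁≡s c₅) ⟩
    s * 5                   ∎)
    where
    open GapCycle c
    open ≡-Reasoning
    c₂ c₃ c₄ c₅ : GapCycle n s t
    c₂ = rotate c
    c₃ = rotate c₂
    c₄ = rotate c₃
    c₅ = rotate c₄
    five-copies : ∀ {a b c d e} → a ≡ s → b ≡ s → c ≡ s → d ≡ s → e ≡ s → a + b + c + d + e ≡ s * 5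
    five-copies refl refl refl refl refl = +-five-copies s

gapCycle : ∀ {n s t y₀ y₁ y₂ y₃ y₄} g₁ g₂ g₃ g₄ r →
           y₀ + g₁ ≡ y₁ → y₁ + g₂ ≡ y₂ → y₂ + g₃ ≡ y₃ → y₃ + g₄ ≡ y₄ → y₄ + r ≡ n →
           Chord n s t y₀ y₁ → Chord n s t y₀ y₂ → Chord n s t y₀ y₃ → Chord n s t y₀ y₄ →
           Chord n s t y₁ y₂ → Chord n s t y₁ y₃ → Chord n s t y₁ y₄ →
           Chord n s t y₂ y₃ → Chord n s t y₂ y₄ → Chord n s t y₃ y₄ → GapCycle n s t
gapCycle {y₀ = y₀} g₁ g₂ g₃ g₄ r refl refl refl refl refl c₀₁ c₀₂ c₀₃ c₀₄ c₁₂ c₁₃ c₁₄ c₂₃ c₂₄ c₃₄ = record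
  { g₁ = g₁ ; g₂ = g₂ ; g₃ = g₃ ; g₄ = g₄ ; g₅ = r + y₀
  ; total = solve vars
  ; adm₁ = admissible-span y₀ g₁ c₀₁ y₁≤n refl
  ; adm₂ = admissible-span (y₀ + g₁) g₂ c₁₂ y₂≤n refl
  ; adm₃ = admissible-span (y₀ + g₁ + g₂) g₃ c₂₃ y₃≤n refl
  ; adm₄ = admissible-span (y₀ + g₁ + g₂ + g₃) g₄ c₃₄ y₄≤n refl
  ; adm₅ = admissible-complement (admissible-span y₀ (g₁ + g₂ + g₃ + g₄) c₀₄ y₄≤n (solve vars)) (solve vars)
  ; adm₁₂ = admissible-span y₀ (g₁ + g₂) c₀₂ y₂≤n (solve vars)
  ; adm₂₃ = admissible-span (y₀ + g₁) (g₂ + g₃) c₁₃ y₃≤n (solve vars)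
  ; adm₃₄ = admissible-span (y₀ + g₁ + g₂) (g₃ + g₄) c₂₄ y₄≤n (solve vars)
  ; adm₄₅ = admissible-complement (admissible-span y₀ (g₁ + g₂ + g₃) c₀₃ y₃≤n (solve vars)) (solve vars)
  ; adm₅₁ = admissible-complement (admissible-span (y₀ + g₁) (g₂ + g₃ + g₄) c₁₄ y₄≤n (solve vars)) (solve vars)
  }
  where
  n : ℕ
  n = y₀ + g₁ + g₂ + g₃ + g₄ + r
  vars : List ℕ
  vars = y₀ ∷ g₁ ∷ g₂ ∷ g₃ ∷ g₄ ∷ r ∷ []
  y₄≤n : y₀ + g₁ + g₂ + g₃ + g₄ ≤ n
  y₄≤n = m≤m+n (y₀ + g₁ + g₂ + g₃ + g₄) r
  y₃≤n : y₀ + g₁ + g₂ + g₃ ≤ n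
  y₃≤n = ≤-trans (m≤m+n (y₀ + g₁ + g₂ + g₃) g₄) y₄≤n
  y₂≤n : y₀ + g₁ + g₂ ≤ n
  y₂≤n = ≤-trans (m≤m+n (y₀ + g₁ + g₂) g₃) y₃≤n
  y₁≤n : y₀ + g₁ ≤ n
  y₁≤n = ≤-trans (m≤m+n (y₀ + g₁) g₂) y₂≤n

sortedPoints⇒gapCycle : ∀ {n s t} ys → length ys ≡ 5 → Linked _≤_ ys → Unique ys → (∀ {y} → y ∈ ys → y < n) →
                        (∀ {x y} → x ∈ ys → y ∈ ys → x ≢ y → Chord n s t x y) → GapCycle n s t
sortedPoints⇒gapCycle {n} (y₀ ∷ y₁ ∷ y₂ ∷ y₃ ∷ y₄ ∷ []) _ (y₀≤y₁ ∷ y₁≤y₂ ∷ y₂≤y₃ ∷ y₃≤y₄ ∷ [-])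
  ((y₀≢y₁ ∷ y₀≢y₂ ∷ y₀≢y₃ ∷ y₀≢y₄ ∷ []) ∷ (y₁≢y₂ ∷ y₁≢y₃ ∷ y₁≢y₄ ∷ []) ∷ (y₂≢y₃ ∷ y₂≢y₄ ∷ []) ∷ (y₃≢y₄ ∷ []) ∷ [] ∷ [])
  bounded chord =
  gapCycle (y₁ ∸ y₀) (y₂ ∸ y₁) (y₃ ∸ y₂) (y₄ ∸ y₃) (n ∸ y₄)
    (m+[n∸m]≡n y₀≤y₁) (m+[n∸m]≡n y₁≤y₂) (m+[n∸m]≡n y₂≤y₃) (m+[n∸m]≡n y₃≤y₄) (m+[n∸m]≡n (<⇒≤ (bounded ∈₄)))
    (chord ∈₀ ∈₁ y₀≢y₁) (chord ∈₀ ∈₂ y₀≢y₂) (chord ∈₀ ∈₃ y₀≢y₃) (chord ∈₀ ∈₄ y₀≢y₄)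
    (chord ∈₁ ∈₂ y₁≢y₂) (chord ∈₁ ∈₃ y₁≢y₃) (chord ∈₁ ∈₄ y₁≢y₄)
    (chord ∈₂ ∈₃ y₂≢y₃) (chord ∈₂ ∈₄ y₂≢y₄) (chord ∈₃ ∈₄ y₃≢y₄)
  where
  ys : List ℕ
  ys = y₀ ∷ y₁ ∷ y₂ ∷ y₃ ∷ y₄ ∷ []
  ∈₀ : y₀ ∈ ys
  ∈₀ = here refl
  ∈₁ : y₁ ∈ ys
  ∈₁ = there (here refl)
  ∈₂ : y₂ ∈ ys
  ∈₂ = there (there (here refl))
  ∈₃ : y₃ ∈ ys
  ∈₃ = there (there (there (here refl)))
  ∈₄ : y₄ ∈ ys
  ∈₄ = there (there (there (there (here refl))))
sortedPoints⇒gapCycle []                          () _ _ _ _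
sortedPoints⇒gapCycle (_ ∷ [])                    () _ _ _ _
sortedPoints⇒gapCycle (_ ∷ _ ∷ [])                () _ _ _ _
sortedPoints⇒gapCycle (_ ∷ _ ∷ _ ∷ [])            () _ _ _ _
sortedPoints⇒gapCycle (_ ∷ _ ∷ _ ∷ _ ∷ [])        () _ _ _ _
sortedPoints⇒gapCycle (_ ∷ _ ∷ _ ∷ _ ∷ _ ∷ _ ∷ _) () _ _ _ _

K₅⇒5∣n : ∀ {n s t} → 0 < s → s ≤ t → t + t ≤ n → ContainsK5 n (Pair s t) → 5 ∣ n
K₅⇒5∣n {n} {s} {t} 0<s s≤t t+t≤n (f , f-injective , f-adjacent) =
  gapCycle⇒5∣n 0<s s≤t t+t≤n
    (sortedPoints⇒gapCycle (sort ys) (↭-length (sort-↭ ys)) (sort-↗ ys) unique bounded chord)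
  where
  ys : List ℕ
  ys = tabulate (toℕ ∘ f)

  vertex : ∀ {y} → y ∈ sort ys → Σ (Fin 5) λ a → y ≡ toℕ (f a)
  vertex y∈ = ∈-tabulate⁻ (∈-resp-↭ (sort-↭ ys) y∈)

  unique : Unique (sort ys)
  unique = Unique-resp-↭ (setoid ℕ) (↭⇒↭ₛ (↭-sym (sort-↭ ys))) (tabulate⁺ (f-injective ∘ toℕ-injective))

  bounded : ∀ {y} → y ∈ sort ys → y < n
  bounded y∈ with vertex y∈
  ... | a , refl = toℕ<n (f a)

  chord : ∀ {x y} → x ∈ sort ys → y ∈ sort ys → x ≢ y → Chord n s t x y
  chord x∈ y∈ x≢y with vertex x∈ | vertex y∈
  ... | a , refl | b , refl = proj₂ (f-adjacent a b (x≢y ∘ cong (toℕ ∘ f)))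

scale : ∀ {m} q .{{_ : NonZero q}} → Fin m → Fin (q * m)
scale q i = fromℕ< (*-monoʳ-< q (toℕ<n i))

toℕ-scale : ∀ {m} q .{{_ : NonZero q}} (i : Fin m) → toℕ (scale q i) ≡ q * toℕ i
toℕ-scale q i = toℕ-fromℕ< (*-monoʳ-< q (toℕ<n i))

scale-injective : ∀ {m} q .{{_ : NonZero q}} → Injective _≡_ _≡_ (scale {m} q)
scale-injective q {i} {j} eq =
  toℕ-injective (*-cancelˡ-≡ _ _ q (trans (sym (toℕ-scale q i)) (trans (cong toℕ eq) (toℕ-scale q j))))

scale-adjacent : ∀ {m s t i j} q .{{_ : NonZero q}} →
                 Adj m (Pair s t) i j → Adj (q * m) (Pair (q * s) (q * t)) (scale q i) (scale q j)
scale-adjacent {m} {i = i} {j} q (i≢j , pair) =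
  i≢j ∘ scale-injective q ,
  subst (Pair _ _) (sym distance) (Sum.map (cong (q *_)) (cong (q *_)) pair)
  where
  distance : dist (q * m) (scale q i) (scale q j) ≡ q * dist m i j
  distance = trans (cong₂ (distℕ (q * m)) (toℕ-scale q i) (toℕ-scale q j)) (distℕ-*ˡ q m (toℕ i) (toℕ j))

C₅-pair-1-2 : ∀ (a b : Fin 5) → a ≢ b → Pair 1 2 (dist 5 a b)
C₅-pair-1-2 = toWitness {a? = all? λ a → all? λ b → ¬? (a F.≟ b) →-dec (dist 5 a b ≟ 1 ⊎-dec dist 5 a b ≟ 2)} _

scaled-C₅-K₅ : ∀ q .{{_ : NonZero q}} → ContainsK5 (q * 5) (Pair (q * 1) (q * 2))
scaled-C₅-K₅ q = scale q , scale-injective q , λ a b a≢b → scale-adjacent q (a≢b , C₅-pair-1-2 a b a≢b)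

5∣n⇒K₅ : ∀ n → 4 ≤ n → 5 ∣ n →
         Σ ℕ λ s → Σ ℕ λ t → (1 ≤ s × s < t × t ≤ n / 2) × ContainsK5 n (Pair s t)
5∣n⇒K₅ _ 4≤0 (divides zero refl) = contradiction 4≤0 λ ()
5∣n⇒K₅ _ _ (divides q@(suc _) refl) =
  q * 1 , q * 2 , (s≤s z≤n , *-monoʳ-< q (s≤s (s≤s z≤n)) , +≤⇒≤/2 q*2+q*2≤q*5) , scaled-C₅-K₅ q
  where
  q*2+q*2≤q*5 : q * 2 + q * 2 ≤ q * 5
  q*2+q*2≤q*5 = subst (_≤ q * 5) (*-distribˡ-+ q 2 2) (*-monoʳ-≤ q (s≤s (s≤s (s≤s (s≤s z≤n)))))

theorem3p3p1 : (n : ℕ) → 4 ≤ n →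
    (Σ ℕ λ s → Σ ℕ λ t → (1 ≤ s × s < t × t ≤ n / 2) × ContainsK5 n (Pair s t))
    ⇔ (5 ∣ n)
theorem3p3p1 n 4≤n = mk⇔
  (λ (_ , _ , (1≤s , s<t , t≤n/2) , K₅) → K₅⇒5∣n 1≤s (<⇒≤ s<t) (≤/2⇒+≤ t≤n/2) K₅)
  (5∣n⇒K₅ n 4≤n)
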